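{- Let $G$ be a connected cactus graph, let $e_1$ be a bridge of $G$ (an edge not contained in any cycle) and let $e_2$ be an edge contained in an even cycle of $G$. Then every very strong rainbow coloring of $G$ colors $e_1$ and $e_2$ with different colors.
   Context: All graphs are finite, simple and undirected. A cactus graph is a graph in which every edge belongs to at most one cycle. A very strong rainbow coloring of $G$ is a coloring of $E(G)$ such that for every pair of vertices and every shortest path between them, all edges of that path receive pairwise different colors. -}

module Defs where

open import Data.Nat using (ℕ; _≤_)
open import Data.Nat.Divisibility using (_∣_)
open import Data.Fin using (Fin)
open import Data.Bool using (Bool; T)
open import Data.List using (List; []; _∷_; _++_; [_]; length; map; head; last)
open import Data.List.Relation.Unary.All using (All)
open import Data.List.Relation.Unary.Unique.Propositional using (Unique)
open import Data.List.Membership.Propositional using (_∈_)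
open import Data.Maybe using (just)
open import Data.Product using (_×_; _,_; Σ; uncurry)
open import Data.Sum using (_⊎_)
open import Data.Empty using (⊥)
open import Relation.Binary.PropositionalEquality using (_≡_)
open import Relation.Nullary using (¬_)

record Graph : Set where
  field
    n      : ℕ
    adj    : Fin n → Fin n → Bool
    sym    : ∀ x y → adj x y ≡ adj y x
    irrefl : ∀ x → ¬ T (adj x x)

module _ (G : Graph) where
  open Graph G

  V : Set
  V = Fin n

  Adj : V → V → Set
  Adj x y = T (adj x y)

  steps : List V → List (V × V)
  steps (x ∷ y ∷ xs) = (x , y) ∷ steps (y ∷ xs)
  steps _ = []

  IsPath : List V → V → V → Set
  IsPath p u v = head p ≡ just u × last p ≡ just v
               × All (uncurry Adj) (steps p) × Unique p

  len : List V → ℕ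
  len p = length (steps p)

  IsShortestPath : List V → V → V → Set
  IsShortestPath p u v = IsPath p u v × (∀ q → IsPath q u v → len p ≤ len q)

  Connected : Set
  Connected = ∀ u v → Σ (List V) λ p → IsPath p u v

  -- edges of a cycle given as cyclic vertex sequence v₀ … v_{k-1}
  cycleSteps : List V → List (V × V)
  cycleSteps [] = []
  cycleSteps (x ∷ xs) = steps ((x ∷ xs) ++ [ x ])

  IsCycle : List V → Set
  IsCycle c = 3 ≤ length c × Unique c × All (uncurry Adj) (cycleSteps c)

  EdgeOn : V → V → List V → Set
  EdgeOn x y c = (x , y) ∈ cycleSteps c ⊎ (y , x) ∈ cycleSteps c

  -- two cycle representations denote the same cycle (same edge set)
  SameCycle : List V → List V → Set
  SameCycle c d = ∀ x y → (EdgeOn x y c → EdgeOn x y d) × (EdgeOn x y d → EdgeOn x y c)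

  IsCactus : Set
  IsCactus = ∀ x y c d → Adj x y → IsCycle c → IsCycle d
           → EdgeOn x y c → EdgeOn x y d → SameCycle c d

  IsBridge : V → V → Set
  IsBridge x y = Adj x y × (∀ c → IsCycle c → ¬ EdgeOn x y c)

  OnEvenCycle : V → V → Set
  OnEvenCycle x y = Adj x y × Σ (List V) λ c → IsCycle c × 2 ∣ length c × EdgeOn x y c

  -- an edge coloring with colours in C, represented by a function on ordered
  -- pairs that is symmetric on edges
  IsEdgeColoring : {C : Set} → (V → V → C) → Set
  IsEdgeColoring col = ∀ x y → Adj x y → col x y ≡ col y x

  IsVSRC : {C : Set} → (V → V → C) → Set
  IsVSRC col = IsEdgeColoring col ×
    (∀ u v p → IsShortestPath p u v → Unique (map (uncurry col) (steps p)))

-- Fix a vertex s. Along any shortest path from s the parity of the distance from s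
-- alternates, so joining the shortest paths from s to y and to x and erasing loops gives a
-- path from y to x along which it alternates. Closed up by the edge xy this path is a
-- cycle, hence (cactus) the even cycle through xy, and going around an even cycle on which
-- all edges but xy alternate forces xy to alternate too: d(s,x) ≠ d(s,y). Hence some
-- shortest path from s ends with the edge xy, for s = a and for s = b. If b lies on the one
-- from a, that path starts with ab and is rainbow, so ab and xy get different colours
-- (they are different edges, as ab lies on no cycle); symmetrically if a lies on the one
-- from b. Otherwise the two paths join a to b avoiding the edge ab, closing a cycle through
-- the bridge. Constructively shortest paths only exist up to double negation, which is
-- enough since the goal is ⊥.
module Submission where

open import Defs

open import Data.Bool using (T)
open import Data.Empty using (⊥; ⊥-elim)
open import Data.Fin using (Fin; zero; suc)
import Data.Fin.Properties as Fin
open import Data.List using (List; []; _∷_; _++_; [_]; length; map; head; last; reverse)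
open import Data.List.Properties using (++-assoc; ++-identityʳ; length-++; length-++-comm; unfold-reverse)
open import Data.List.Membership.Propositional using (_∈_; _∉_)
open import Data.List.Membership.Propositional.Properties using (∈-++⁺ˡ; ∈-++⁺ʳ; ∈-++⁻; ∈-∃++; ∈-map⁺)
open import Data.List.Relation.Binary.Permutation.Propositional.Properties using (∈-resp-↭; ++-comm)
open import Data.List.Relation.Binary.Subset.Propositional using (_⊆_)
open import Data.List.Relation.Unary.All as All using (All; []; _∷_)
import Data.List.Relation.Unary.All.Properties as All
open import Data.List.Relation.Unary.AllPairs using ([]; _∷_)
open import Data.List.Relation.Unary.Any using (here; there)
open import Data.List.Relation.Unary.Unique.Propositional using (Unique)
import Data.List.Relation.Unary.Unique.Propositional.Properties as Unique
open import Data.Maybe using (just)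
open import Data.Maybe.Properties using (just-injective)
open import Data.Nat using (ℕ; zero; suc; _+_; _*_; _≤_; _<_; z≤n; s≤s; s≤s⁻¹; parity)
open import Data.Nat.Divisibility using (_∣_; divides)
open import Data.Nat.Induction using (<-rec)
open import Data.Nat.Properties
open import Data.Parity.Base as ℙ using (Parity; 0ℙ; 1ℙ; _⁻¹)
open import Data.Parity.Properties using (⁻¹-selfInverse; ⁻¹-involutive; p≢p⁻¹; suc-homo-⁻¹)
open import Data.Product as Product using (∃; ∃₂; _×_; _,_; proj₁; proj₂; uncurry)
open import Data.Sum as Sum using (_⊎_; inj₁; inj₂)
open import Function using (_∘_)
open import Relation.Binary.Definitions using (tri<; tri≈; tri>)
open import Relation.Binary.PropositionalEquality hiding ([_])
open import Relation.Nullary using (¬_; yes; no)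
open import Relation.Nullary.Negation using (¬¬-map)

module _ {A : Set} where

  last-∷ʳ : ∀ (xs : List A) z → last (xs ++ [ z ]) ≡ just z
  last-∷ʳ []           z = refl
  last-∷ʳ (x ∷ [])     z = refl
  last-∷ʳ (x ∷ y ∷ xs) z = last-∷ʳ (y ∷ xs) z

  last-++-∷ : ∀ (xs : List A) w ys → last (xs ++ w ∷ ys) ≡ last (w ∷ ys)
  last-++-∷ []           w ys = refl
  last-++-∷ (x ∷ [])     w ys = refl
  last-++-∷ (x ∷ y ∷ xs) w ys = last-++-∷ (y ∷ xs) w ys

  head-++-∷ : ∀ (xs : List A) w ys → head (xs ++ w ∷ ys) ≡ head (xs ++ [ w ])
  head-++-∷ []       w ys = refl
  head-++-∷ (x ∷ xs) w ys = refl

  head≡just⇒∷ : ∀ {xs : List A} {u} → head xs ≡ just u → ∃ λ xs′ → xs ≡ u ∷ xs′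
  head≡just⇒∷ {x ∷ xs} refl = xs , refl

  last≡just⇒∷ʳ : ∀ {xs : List A} {z} → last xs ≡ just z → ∃ λ xs′ → xs ≡ xs′ ++ [ z ]
  last≡just⇒∷ʳ {x ∷ []}     refl = [] , refl
  last≡just⇒∷ʳ {x ∷ y ∷ xs} eq   = Product.map (x ∷_) (cong (x ∷_)) (last≡just⇒∷ʳ {y ∷ xs} eq)

  head-reverse : ∀ (xs : List A) → head (reverse xs) ≡ last xs
  head-reverse []           = refl
  head-reverse (x ∷ [])     = refl
  head-reverse (x ∷ y ∷ xs) = begin
    head (reverse (x ∷ y ∷ xs))           ≡⟨ cong head (unfold-reverse x (y ∷ xs)) ⟩
    head (reverse (y ∷ xs) ++ [ x ])      ≡⟨ cong (λ l → head (l ++ [ x ])) (unfold-reverse y xs) ⟩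
    head ((reverse xs ++ [ y ]) ++ [ x ]) ≡⟨ cong head (++-assoc (reverse xs) [ y ] [ x ]) ⟩
    head (reverse xs ++ y ∷ [ x ])        ≡⟨ head-++-∷ (reverse xs) y [ x ] ⟩
    head (reverse xs ++ [ y ])            ≡⟨ cong head (unfold-reverse y xs) ⟨
    head (reverse (y ∷ xs))               ≡⟨ head-reverse (y ∷ xs) ⟩
    last (y ∷ xs)                         ∎
    where open ≡-Reasoning

  last-reverse : ∀ (xs : List A) → last (reverse xs) ≡ head xs
  last-reverse []       = refl
  last-reverse (x ∷ xs) = trans (cong last (unfold-reverse x xs)) (last-∷ʳ (reverse xs) x)

  Unique-∷⁺ : ∀ {x : A} {xs} → x ∉ xs → Unique xs → Unique (x ∷ xs)
  Unique-∷⁺ {xs = xs} x∉xs u = All.¬Any⇒All¬ xs x∉xs ∷ u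

  Unique-++⁻ˡ : ∀ (xs : List A) {ys} → Unique (xs ++ ys) → Unique xs
  Unique-++⁻ˡ []       u        = []
  Unique-++⁻ˡ (x ∷ xs) (px ∷ u) = All.++⁻ˡ xs px ∷ Unique-++⁻ˡ xs u

  Unique-++⁻ʳ : ∀ (xs : List A) {ys} → Unique (xs ++ ys) → Unique ys
  Unique-++⁻ʳ []       u       = u
  Unique-++⁻ʳ (x ∷ xs) (_ ∷ u) = Unique-++⁻ʳ xs u

  Unique-++⇒disjoint : ∀ (xs : List A) {ys z} → Unique (xs ++ ys) → z ∈ xs → z ∉ ys
  Unique-++⇒disjoint (x ∷ xs) (px ∷ u) (here refl)  z∈ys = All.lookup px (∈-++⁺ʳ xs z∈ys) refl
  Unique-++⇒disjoint (x ∷ xs) (px ∷ u) (there z∈xs)      = Unique-++⇒disjoint xs u z∈xs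

  Unique-++-comm : ∀ (xs : List A) {ys} → Unique (xs ++ ys) → Unique (ys ++ xs)
  Unique-++-comm xs {ys} u = Unique.++⁺ (Unique-++⁻ʳ xs u) (Unique-++⁻ˡ xs u)
    (λ (z∈ys , z∈xs) → Unique-++⇒disjoint xs u z∈xs z∈ys)

  Unique-∷ʳ⁺ : ∀ (xs : List A) {z} → Unique xs → z ∉ xs → Unique (xs ++ [ z ])
  Unique-∷ʳ⁺ xs u z∉xs = Unique.++⁺ u ([] ∷ []) λ { (z∈xs , here refl) → z∉xs z∈xs }

module _ {A B : Set} (f : A → B) where

  Unique-map⇒injectiveOn : ∀ xs {x y} → Unique (map f xs) → x ∈ xs → y ∈ xs → f x ≡ f y → x ≡ y
  Unique-map⇒injectiveOn (z ∷ xs) (pz ∷ u) (here refl) (here refl) eq = refl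
  Unique-map⇒injectiveOn (z ∷ xs) (pz ∷ u) (here refl) (there y∈) eq =
    ⊥-elim (All.lookup pz (∈-map⁺ f y∈) eq)
  Unique-map⇒injectiveOn (z ∷ xs) (pz ∷ u) (there x∈) (here refl) eq =
    ⊥-elim (All.lookup pz (∈-map⁺ f x∈) (sym eq))
  Unique-map⇒injectiveOn (z ∷ xs) (pz ∷ u) (there x∈) (there y∈) eq = Unique-map⇒injectiveOn xs u x∈ y∈ eq

¬¬-minimal : (P : ℕ → Set) → ∀ m → P m → ¬ ¬ (∃ λ k → P k × ∀ j → P j → k ≤ j)
¬¬-minimal P = <-rec (λ m → P m → ¬ ¬ _) λ m rec pm ¬min →
  ¬min (m , pm , λ j pj → ≮⇒≥ λ j<m → rec j<m pj ¬min)

¬¬-Π-Fin : ∀ {m} {P : Fin m → Set} → (∀ i → ¬ ¬ P i) → ¬ ¬ (∀ i → P i)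
¬¬-Π-Fin {zero}  _   k = k λ ()
¬¬-Π-Fin {suc m} ¬¬P k =
  ¬¬P zero λ p₀ → ¬¬-Π-Fin (¬¬P ∘ suc) λ ps → k λ { zero → p₀ ; (suc i) → ps i }

parity-suc : ∀ n → parity (suc n) ≡ parity n ⁻¹
parity-suc n = sym (⁻¹-selfInverse (suc-homo-⁻¹ n))

parity-suc-+-⁻¹ : ∀ n p → parity (suc n) ℙ.+ p ⁻¹ ≡ parity (suc (suc n)) ℙ.+ p
parity-suc-+-⁻¹ zero          p = ⁻¹-involutive p
parity-suc-+-⁻¹ (suc zero)    p = refl
parity-suc-+-⁻¹ (suc (suc n)) p = parity-suc-+-⁻¹ n p

parity-*2 : ∀ q → parity (q * 2) ≡ 0ℙ
parity-*2 zero    = refl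
parity-*2 (suc q) = parity-*2 q

2∣2+n⇒parity-1+n : ∀ n → 2 ∣ suc (suc n) → parity (suc n) ≡ 1ℙ
2∣2+n⇒parity-1+n n (divides q eq) =
  trans (sym (suc-homo-⁻¹ (suc n))) (cong _⁻¹ (trans (cong parity eq) (parity-*2 q)))

module _ (G : Graph) where

  Adj-sym : ∀ {u v} → Adj G u v → Adj G v u
  Adj-sym {u} {v} = subst T (Graph.sym G u v)

  Adj⇒≢ : ∀ {u v} → Adj G u v → u ≢ v
  Adj⇒≢ {u} adj refl = Graph.irrefl G u adj

  steps-++ : ∀ xs t ys → steps G (xs ++ t ∷ ys) ≡ steps G (xs ++ [ t ]) ++ steps G (t ∷ ys)
  steps-++ []           t ys = refl
  steps-++ (x ∷ [])     t ys = refl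
  steps-++ (x ∷ y ∷ xs) t ys = cong ((x , y) ∷_) (steps-++ (y ∷ xs) t ys)

  steps-prefix : ∀ xs t ys → steps G (xs ++ [ t ]) ⊆ steps G (xs ++ t ∷ ys)
  steps-prefix xs t ys e∈ = subst (_ ∈_) (sym (steps-++ xs t ys)) (∈-++⁺ˡ e∈)

  steps-suffix : ∀ xs t ys → steps G (t ∷ ys) ⊆ steps G (xs ++ t ∷ ys)
  steps-suffix xs t ys e∈ = subst (_ ∈_) (sym (steps-++ xs t ys)) (∈-++⁺ʳ _ e∈)

  steps-∷ : ∀ x xs → steps G xs ⊆ steps G (x ∷ xs)
  steps-∷ x []       ()
  steps-∷ x (y ∷ xs) e∈ = there e∈

  ∈-steps⇒∈ˡ : ∀ xs {u v} → (u , v) ∈ steps G xs → u ∈ xs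
  ∈-steps⇒∈ˡ (x ∷ y ∷ xs) (here refl) = here refl
  ∈-steps⇒∈ˡ (x ∷ y ∷ xs) (there e∈)  = there (∈-steps⇒∈ˡ (y ∷ xs) e∈)

  ∈-steps⇒∈ʳ : ∀ xs {u v} → (u , v) ∈ steps G xs → v ∈ xs
  ∈-steps⇒∈ʳ (x ∷ y ∷ xs) (here refl) = there (here refl)
  ∈-steps⇒∈ʳ (x ∷ y ∷ xs) (there e∈)  = there (∈-steps⇒∈ʳ (y ∷ xs) e∈)

  ∈-steps-∷ʳ⇒∈ : ∀ xs z {u v} → (u , v) ∈ steps G (xs ++ [ z ]) → u ∈ xs
  ∈-steps-∷ʳ⇒∈ (x ∷ [])     z (here refl) = here refl
  ∈-steps-∷ʳ⇒∈ (x ∷ y ∷ xs) z (here refl) = here refl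
  ∈-steps-∷ʳ⇒∈ (x ∷ y ∷ xs) z (there e∈)  = there (∈-steps-∷ʳ⇒∈ (y ∷ xs) z e∈)

  ∈-steps⇒∃++ : ∀ xs {u v} → (u , v) ∈ steps G xs → ∃₂ λ ys zs → xs ≡ ys ++ u ∷ v ∷ zs
  ∈-steps⇒∃++ (x ∷ y ∷ xs) (here refl) = [] , xs , refl
  ∈-steps⇒∃++ (x ∷ y ∷ xs) (there e∈) with ∈-steps⇒∃++ (y ∷ xs) e∈
  ... | ys , zs , eq = x ∷ ys , zs , cong (x ∷_) eq

  ∈-steps-∷ʳ⁻ : ∀ xs z {u v} → (u , v) ∈ steps G (xs ++ [ z ]) →
                (u , v) ∈ steps G xs ⊎ (last xs ≡ just u × v ≡ z)
  ∈-steps-∷ʳ⁻ (x ∷ [])     z (here refl) = inj₂ (refl , refl)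
  ∈-steps-∷ʳ⁻ (x ∷ y ∷ xs) z (here refl) = inj₁ (here refl)
  ∈-steps-∷ʳ⁻ (x ∷ y ∷ xs) z (there e∈)  = Sum.map₁ there (∈-steps-∷ʳ⁻ (y ∷ xs) z e∈)

  ∈-steps-∷ʳ⁺ : ∀ xs z {u} → last xs ≡ just u → (u , z) ∈ steps G (xs ++ [ z ])
  ∈-steps-∷ʳ⁺ (x ∷ [])     z refl = here refl
  ∈-steps-∷ʳ⁺ (x ∷ y ∷ xs) z eq   = there (∈-steps-∷ʳ⁺ (y ∷ xs) z eq)

  ∈-steps-reverse : ∀ xs {u v} → (u , v) ∈ steps G (reverse xs) → (v , u) ∈ steps G xs
  ∈-steps-reverse (x ∷ xs) e∈
    with ∈-steps-∷ʳ⁻ (reverse xs) x (subst (_ ∈_) (cong (steps G) (unfold-reverse x xs)) e∈)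
  ... | inj₁ e∈′ = steps-∷ x xs (∈-steps-reverse xs e∈′)
  ... | inj₂ (last≡u , refl) with head≡just⇒∷ (trans (sym (last-reverse xs)) last≡u)
  ...   | xs′ , refl = here refl

  len-∷ : ∀ x xs → len G (x ∷ xs) ≡ length xs
  len-∷ x []       = refl
  len-∷ x (y ∷ xs) = cong suc (len-∷ y xs)

  len-∷ʳ : ∀ xs t → len G (xs ++ [ t ]) ≡ length xs
  len-∷ʳ []           t = refl
  len-∷ʳ (x ∷ [])     t = refl
  len-∷ʳ (x ∷ y ∷ xs) t = cong suc (len-∷ʳ (y ∷ xs) t)

  len-++ : ∀ xs t ys → len G (xs ++ t ∷ ys) ≡ length xs + length ys
  len-++ xs t ys = begin
    len G (xs ++ t ∷ ys)                               ≡⟨ cong length (steps-++ xs t ys) ⟩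
    length (steps G (xs ++ [ t ]) ++ steps G (t ∷ ys)) ≡⟨ length-++ (steps G (xs ++ [ t ])) ⟩
    len G (xs ++ [ t ]) + len G (t ∷ ys)               ≡⟨ cong₂ _+_ (len-∷ʳ xs t) (len-∷ t ys) ⟩
    length xs + length ys                              ∎
    where open ≡-Reasoning

  open import Data.List.Membership.DecPropositional (Fin._≟_ {Graph.n G}) using (_∈?_)

  IsWalk : List (V G) → V G → V G → Set
  IsWalk p u v = head p ≡ just u × last p ≡ just v × All (uncurry (Adj G)) (steps G p)

  path⇒walk : ∀ {p u v} → IsPath G p u v → IsWalk p u v
  path⇒walk (h , l , adj , _) = h , l , adj

  walk-reverse : ∀ {p u v} → IsWalk p u v → IsWalk (reverse p) v u
  walk-reverse {p} (h , l , adj) =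
    trans (head-reverse p) l , trans (last-reverse p) h ,
    All.tabulate λ e∈ → Adj-sym (All.lookup adj (∈-steps-reverse p e∈))

  walk-++ : ∀ {p q u t v} → IsWalk p u t → IsWalk q t v →
            ∃ λ r → IsWalk r u v × steps G r ≡ steps G p ++ steps G q
  walk-++ {p} {q} {t = t} (hp , lp , adjp) (hq , lq , adjq)
    with last≡just⇒∷ʳ {xs = p} lp | head≡just⇒∷ {xs = q} hq
  ... | p′ , refl | q′ , refl =
    p′ ++ t ∷ q′ ,
    (trans (head-++-∷ p′ t q′) hp , trans (last-++-∷ p′ t q′) lq ,
     subst (All _) (sym (steps-++ p′ t q′)) (All.++⁺ adjp adjq)) ,
    steps-++ p′ t q′

  walk-∷ʳ : ∀ {p u t z} → IsWalk p u t → Adj G t z → IsWalk (p ++ [ z ]) u z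
  walk-∷ʳ {p} {z = z} (h , l , adj) t~z with head≡just⇒∷ {xs = p} h
  ... | p′ , refl = refl , last-∷ʳ p z , All.tabulate step
    where
    step : ∀ {e} → e ∈ steps G (p ++ [ z ]) → uncurry (Adj G) e
    step {_ , _} e∈ with ∈-steps-∷ʳ⁻ p z e∈
    ... | inj₁ e∈p = All.lookup adj e∈p
    ... | inj₂ (l′ , refl) with just-injective (trans (sym l) l′)
    ...   | refl = t~z

  loop-erase : ∀ v ws → ∃ λ p → Unique (v ∷ p) × last (v ∷ p) ≡ last (v ∷ ws)
                              × steps G (v ∷ p) ⊆ steps G (v ∷ ws) × length p ≤ length ws
  loop-erase v []       = [] , [] ∷ [] , refl , (λ ()) , z≤n
  loop-erase v (w ∷ ws) with loop-erase w ws
  ... | p , uniq , l , ⊆ws , ≤ws with v ∈? (w ∷ p)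
  ...   | no v∉ =
    w ∷ p , Unique-∷⁺ v∉ uniq , l , (λ { (here e) → here e ; (there e∈) → there (⊆ws e∈) }) , s≤s ≤ws
  ...   | yes v∈ with ∈-∃++ v∈
  ...     | A , B , eq =
    B , Unique-++⁻ʳ A (subst Unique eq uniq) , l′ , ⊆′ , m≤n⇒m≤1+n (≤-trans B≤p ≤ws)
    where
    l′ : last (v ∷ B) ≡ last (w ∷ ws)
    l′ = trans (sym (last-++-∷ A v B)) (trans (cong last (sym eq)) l)
    ⊆′ : steps G (v ∷ B) ⊆ steps G (v ∷ w ∷ ws)
    ⊆′ e∈ = there (⊆ws (subst (λ l → _ ∈ steps G l) (sym eq) (steps-suffix A v B e∈)))
    B≤p : length B ≤ length p
    B≤p = s≤s⁻¹ (subst (suc (length B) ≤_) (trans (sym (length-++ A)) (cong length (sym eq)))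
                       (m≤n+m (suc (length B)) (length A)))

  walk⇒path : ∀ {w u v} → IsWalk w u v →
              ∃ λ p → IsPath G p u v × steps G p ⊆ steps G w × len G p ≤ len G w
  walk⇒path {u ∷ ws} (refl , l , adj) with loop-erase u ws
  ... | p , uniq , l′ , ⊆ws , ≤ws =
    u ∷ p , (refl , trans l′ l , All.anti-mono ⊆ws adj , uniq) , ⊆ws ,
    subst₂ _≤_ (sym (len-∷ u p)) (sym (len-∷ u ws)) ≤ws

  edge-path : ∀ {u v} → Adj G u v → IsPath G (u ∷ [ v ]) u v
  edge-path u~v =
    refl , refl , u~v ∷ [] , Unique-∷⁺ (λ { (here u≡v) → Adj⇒≢ u~v u≡v ; (there ()) }) ([] ∷ [])

  path-prefix : ∀ {s t} xs w ys → IsPath G (xs ++ w ∷ ys) s t → IsPath G (xs ++ [ w ]) s w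
  path-prefix xs w ys (h , l , adj , uniq) =
    trans (sym (head-++-∷ xs w ys)) h , last-∷ʳ xs w , All.anti-mono (steps-prefix xs w ys) adj ,
    Unique-++⁻ˡ (xs ++ [ w ]) (subst Unique (sym (++-assoc xs [ w ] ys)) uniq)

  path-suffix : ∀ {s t} xs w ys → IsPath G (xs ++ w ∷ ys) s t → IsPath G (w ∷ ys) w t
  path-suffix xs w ys (h , l , adj , uniq) =
    refl , trans (sym (last-++-∷ xs w ys)) l , All.anti-mono (steps-suffix xs w ys) adj ,
    Unique-++⁻ʳ xs uniq

  path-prefix-to : ∀ {p s t w} → IsPath G p s t → w ∈ p →
                   ∃ λ q → IsPath G q s w × q ⊆ p × len G q ≤ len G p
  path-prefix-to {w = w} pp w∈p with ∈-∃++ w∈p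
  ... | xs , ys , refl =
    xs ++ [ w ] , path-prefix xs w ys pp ,
    (λ v∈ → subst (_ ∈_) (++-assoc xs [ w ] ys) (∈-++⁺ˡ v∈)) ,
    subst₂ _≤_ (sym (len-∷ʳ xs w)) (sym (len-++ xs w ys)) (m≤m+n (length xs) (length ys))

  path-∷ʳ : ∀ {p s t z} → IsPath G p s t → z ∉ p → Adj G t z → IsPath G (p ++ [ z ]) s z
  path-∷ʳ {p} pp@(_ , _ , _ , uniq) z∉p t~z with walk-∷ʳ (path⇒walk pp) t~z
  ... | h , l , adj = h , l , adj , Unique-∷ʳ⁺ p uniq z∉p

  path-closes-cycle : ∀ {u p v} → IsPath G (u ∷ p) u v → Adj G v u → 3 ≤ length (u ∷ p) →
                      IsCycle G (u ∷ p) × (v , u) ∈ cycleSteps G (u ∷ p)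
  path-closes-cycle {u} {p} pp@(_ , l , _ , uniq) v~u 3≤ =
    (3≤ , uniq , proj₂ (proj₂ (walk-∷ʳ (path⇒walk pp) v~u))) , ∈-steps-∷ʳ⁺ (u ∷ p) u l

  shortest-len-unique : ∀ {p q s t} → IsShortestPath G p s t → IsShortestPath G q s t → len G p ≡ len G q
  shortest-len-unique (pp , minp) (qp , minq) = ≤-antisym (minp _ qp) (minq _ pp)

  shortest-prefix : ∀ {s t} xs w ys → IsShortestPath G (xs ++ w ∷ ys) s t →
                    IsShortestPath G (xs ++ [ w ]) s w
  shortest-prefix {s} xs w ys (pp , min) = path-prefix xs w ys pp , λ q qp →
    subst (_≤ len G q) (sym (len-∷ʳ xs w)) (+-cancelʳ-≤ (length ys) (length xs) (len G q) (through q qp))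
    where
    through : ∀ q → IsPath G q s w → length xs + length ys ≤ len G q + length ys
    through q qp with walk-++ (path⇒walk qp) (path⇒walk (path-suffix xs w ys pp))
    ... | r , rw , steps-r with walk⇒path rw
    ...   | r′ , r′p , _ , r′≤r = begin
      length xs + length ys                  ≡⟨ len-++ xs w ys ⟨
      len G (xs ++ w ∷ ys)                   ≤⟨ min r′ r′p ⟩
      len G r′                               ≤⟨ r′≤r ⟩
      len G r                                ≡⟨ cong length steps-r ⟩
      length (steps G q ++ steps G (w ∷ ys)) ≡⟨ length-++ (steps G q) ⟩
      len G q + len G (w ∷ ys)               ≡⟨ cong (len G q +_) (len-∷ w ys) ⟩
      len G q + length ys                    ∎
      where open ≤-Reasoning

  shortest-through-neighbour : ∀ {p s s′ t} → IsShortestPath G p s t → Adj G s s′ → s′ ∈ p →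
                               ∃ λ ys → p ≡ s ∷ s′ ∷ ys
  shortest-through-neighbour {s = s} {s′} sp s~s′ s′∈p with ∈-∃++ s′∈p
  ... | xs , ys , refl = initial xs xs≤1 (proj₁ (proj₁ sp))
    where
    xs≤1 : length xs ≤ 1
    xs≤1 = subst (_≤ 1) (len-∷ʳ xs s′)
                 (proj₂ (shortest-prefix xs s′ ys sp) (s ∷ [ s′ ]) (edge-path s~s′))
    initial : ∀ xs → length xs ≤ 1 → head (xs ++ s′ ∷ ys) ≡ just s →
              ∃ λ ys′ → xs ++ s′ ∷ ys ≡ s ∷ s′ ∷ ys′
    initial []          _        h    = ⊥-elim (Adj⇒≢ s~s′ (sym (just-injective h)))
    initial (x ∷ [])    _        refl = ys , refl
    initial (x ∷ y ∷ _) (s≤s ()) _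

  shortest-∷ʳ : ∀ {p q s x y} → IsShortestPath G p s x → IsShortestPath G q s y → len G p < len G q →
                Adj G x y → IsShortestPath G (p ++ [ y ]) s y
  shortest-∷ʳ {p} {q} {y = y} (pp , minp) (qp , minq) p<q x~y = path-∷ʳ pp y∉p x~y , λ r rp →
    subst (_≤ len G r) (sym (len-∷ʳ p y)) (≤-trans (length≤ p) (≤-trans p<q (minq r rp)))
    where
    y∉p : y ∉ p
    y∉p y∈p with path-prefix-to pp y∈p
    ... | r , rp , _ , r≤p = <⇒≱ p<q (≤-trans (minq r rp) r≤p)
    length≤ : ∀ p → length p ≤ suc (len G p)
    length≤ []       = z≤n
    length≤ (v ∷ vs) = s≤s (≤-reflexive (sym (len-∷ v vs)))

  shortest-path-exists : Connected G → ∀ u v → ¬ ¬ (∃ λ p → IsShortestPath G p u v)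
  shortest-path-exists conn u v with conn u v
  ... | p₀ , p₀p = ¬¬-map minimal⇒shortest (¬¬-minimal PathOfLength (len G p₀) (p₀ , p₀p , refl))
    where
    PathOfLength : ℕ → Set
    PathOfLength m = ∃ λ p → IsPath G p u v × len G p ≡ m
    minimal⇒shortest : (∃ λ k → PathOfLength k × ∀ j → PathOfLength j → k ≤ j) →
                       ∃ λ p → IsShortestPath G p u v
    minimal⇒shortest (_ , (p , pp , refl) , min) = p , pp , λ q qp → min (len G q) (q , qp , refl)

  shortest-paths-from : Connected G → ∀ s → ¬ ¬ (∀ v → ∃ λ p → IsShortestPath G p s v)
  shortest-paths-from conn s = ¬¬-Π-Fin (shortest-path-exists conn s)

  cycleSteps-split : ∀ u xs w ys →
                     cycleSteps G (u ∷ xs ++ w ∷ ys) ≡ steps G (u ∷ xs ++ [ w ]) ++ steps G (w ∷ ys ++ [ u ])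
  cycleSteps-split u xs w ys =
    trans (cong (λ l → steps G (u ∷ l)) (++-assoc xs (w ∷ ys) [ u ])) (steps-++ (u ∷ xs) w (ys ++ [ u ]))

  cycleSteps-rotate : ∀ xs w ys → cycleSteps G (xs ++ w ∷ ys) ⊆ cycleSteps G (w ∷ ys ++ xs)
  cycleSteps-rotate []       w ys = subst (λ l → _ ∈ cycleSteps G (w ∷ l)) (sym (++-identityʳ ys))
  cycleSteps-rotate (u ∷ xs) w ys e∈ =
    subst (_ ∈_) (sym (cycleSteps-split w ys u xs))
      (∈-resp-↭ (++-comm (steps G (u ∷ xs ++ [ w ])) _) (subst (_ ∈_) (cycleSteps-split u xs w ys) e∈))

  cycleSteps-unrotate : ∀ xs w ys → cycleSteps G (w ∷ ys ++ xs) ⊆ cycleSteps G (xs ++ w ∷ ys)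
  cycleSteps-unrotate []       w ys = subst (λ l → _ ∈ cycleSteps G (w ∷ l)) (++-identityʳ ys)
  cycleSteps-unrotate (u ∷ xs) w ys = cycleSteps-rotate (w ∷ ys) u xs

  cycle-step-from-head : ∀ {a b} L → a ∉ L → a ≢ b → (a , b) ∈ cycleSteps G (a ∷ L) →
                         ∃ λ rest → L ≡ b ∷ rest
  cycle-step-from-head []      _   a≢b (here refl) = ⊥-elim (a≢b refl)
  cycle-step-from-head []      _   _   (there ())
  cycle-step-from-head (l ∷ L) _   _   (here refl) = L , refl
  cycle-step-from-head (l ∷ L) a∉L _   (there e∈)  = ⊥-elim (a∉L (∈-steps-∷ʳ⇒∈ (l ∷ L) _ e∈))

  cycle-rotate-to : ∀ {c a b} → IsCycle G c → (a , b) ∈ cycleSteps G c →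
                    ∃ λ L → Unique (a ∷ L) × length (a ∷ L) ≡ length c
                          × (a , b) ∈ cycleSteps G (a ∷ L) × cycleSteps G (a ∷ L) ⊆ cycleSteps G c
  cycle-rotate-to {v ∷ vs} {a} (_ , uniq , _) ab∈ with ∈-∃++ (∈-steps-∷ʳ⇒∈ (v ∷ vs) v ab∈)
  ... | xs , ys , eq =
    ys ++ xs ,
    Unique-++-comm xs (subst Unique eq uniq) ,
    trans (length-++-comm (a ∷ ys) xs) (cong length (sym eq)) ,
    cycleSteps-rotate xs a ys (subst (λ l → _ ∈ cycleSteps G l) eq ab∈) ,
    subst (λ l → _ ∈ cycleSteps G l) (sym eq) ∘ cycleSteps-unrotate xs a ys

  cycle-open : ∀ {c a b} → IsCycle G c → (a , b) ∈ cycleSteps G c →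
               ∃ λ rest → a ∉ rest × b ∉ rest × length c ≡ suc (suc (length rest))
                        × steps G (b ∷ rest ++ [ a ]) ⊆ cycleSteps G c
  cycle-open cyc@(_ , _ , adj) ab∈ with cycle-rotate-to cyc ab∈
  ... | L , uniq , len≡ , ab∈′ , ⊆c
    with cycle-step-from-head L (Unique.Unique[x∷xs]⇒x∉xs uniq) (Adj⇒≢ (All.lookup adj ab∈)) ab∈′
  ... | rest , refl =
    rest , Unique.Unique[x∷xs]⇒x∉xs uniq ∘ there , Unique.Unique[x∷xs]⇒x∉xs (Unique-++⁻ʳ [ _ ] uniq) ,
    sym len≡ , ⊆c ∘ there

  Orientation : V G × V G → V G → V G → Set
  Orientation (u , v) a b = (u ≡ a × v ≡ b) ⊎ (u ≡ b × v ≡ a)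

  Alternates : (V G → Parity) → V G × V G → Set
  Alternates g (u , v) = g v ≡ g u ⁻¹

  Alternates-sym : ∀ g {u v} → Alternates g (u , v) → Alternates g (v , u)
  Alternates-sym g alt = sym (⁻¹-selfInverse (sym alt))

  alternating-parity : ∀ g x xs z → All (Alternates g) (steps G (x ∷ xs ++ [ z ])) →
                       g z ≡ parity (suc (length xs)) ℙ.+ g x
  alternating-parity g x []       z (alt ∷ [])   = alt
  alternating-parity g x (y ∷ xs) z (alt ∷ alts) = begin
    g z                                    ≡⟨ alternating-parity g y xs z alts ⟩
    parity (suc (length xs)) ℙ.+ g y       ≡⟨ cong (parity (suc (length xs)) ℙ.+_) alt ⟩
    parity (suc (length xs)) ℙ.+ g x ⁻¹    ≡⟨ parity-suc-+-⁻¹ (length xs) (g x) ⟩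
    parity (suc (suc (length xs))) ℙ.+ g x ∎
    where open ≡-Reasoning

  steps-avoid-edge : ∀ {a b} r rest {u v} → a ≢ b → a ∉ r ∷ rest → b ∉ r ∷ rest →
                     (u , v) ∈ steps G (b ∷ r ∷ rest ++ [ a ]) → ¬ Orientation (u , v) a b
  steps-avoid-edge r rest a≢b a∉ b∉ (here refl) (inj₁ (b≡a , _)) = a≢b (sym b≡a)
  steps-avoid-edge r rest a≢b a∉ b∉ (here refl) (inj₂ (_ , r≡a)) = a∉ (here (sym r≡a))
  steps-avoid-edge r rest a≢b a∉ b∉ (there e∈)  (inj₁ (refl , _)) = a∉ (∈-steps-∷ʳ⇒∈ (r ∷ rest) _ e∈)
  steps-avoid-edge r rest a≢b a∉ b∉ (there e∈)  (inj₂ (refl , _)) = b∉ (∈-steps-∷ʳ⇒∈ (r ∷ rest) _ e∈)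

  -- Going around the even cycle from b back to a crosses an odd number of alternating edges.
  even-cycle-alternates : ∀ g {c a b} → IsCycle G c → 2 ∣ length c → (a , b) ∈ cycleSteps G c →
    (∀ {u v} → (u , v) ∈ cycleSteps G c → Alternates g (u , v) ⊎ Orientation (u , v) a b) →
    Alternates g (a , b)
  even-cycle-alternates g {c} {a} {b} cyc@(3≤ , _ , adj) even ab∈ alt-or-ab with cycle-open cyc ab∈
  ... | [] , _ , _ , len≡ , _ = ⊥-elim (<⇒≱ (subst (2 <_) len≡ 3≤) ≤-refl)
  ... | r ∷ rest , a∉ , b∉ , len≡ , ⊆c = Alternates-sym g (begin
    g a                                      ≡⟨ alternating-parity g b (r ∷ rest) a alts ⟩
    parity (suc (length (r ∷ rest))) ℙ.+ g b ≡⟨ cong (ℙ._+ g b) (2∣2+n⇒parity-1+n _ c-even) ⟩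
    g b ⁻¹                                   ∎)
    where
    open ≡-Reasoning
    c-even : 2 ∣ suc (suc (length (r ∷ rest)))
    c-even = subst (2 ∣_) len≡ even
    alts : All (Alternates g) (steps G (b ∷ (r ∷ rest) ++ [ a ]))
    alts = All.tabulate λ { {_ , _} e∈ →
      Sum.[ (λ alt → alt) , ⊥-elim ∘ steps-avoid-edge r rest (Adj⇒≢ (All.lookup adj ab∈)) a∉ b∉ e∈ ]
        (alt-or-ab (⊆c e∈)) }

  -- Closed up by xy, R is a cycle through xy, hence c itself; so all other edges of c alternate.
  cactus-even-cycle-alternates : ∀ g {x y c R} → IsCactus G → Adj G x y →
    IsCycle G c → 2 ∣ length c → EdgeOn G x y c →
    IsPath G R y x → All (Alternates g) (steps G R) → Alternates g (x , y)
  cactus-even-cycle-alternates g {x} {y} {c} {R} cactus x~y cyc even xy-on-c Rp@(h , l , _) alts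
    with head≡just⇒∷ {xs = R} h
  ... | []         , refl = ⊥-elim (Adj⇒≢ x~y (sym (just-injective l)))
  ... | r ∷ []     , refl with just-injective l
  ...   | refl = Alternates-sym g (All.lookup alts (here refl))
  cactus-even-cycle-alternates g {x} {y} {c} {R} cactus x~y cyc even xy-on-c Rp@(h , l , _) alts
      | r ∷ r′ ∷ R′ , refl = Sum.[ alternates-xy , alternates-yx ] xy-on-c
    where
    closed : IsCycle G R × (x , y) ∈ cycleSteps G R
    closed = path-closes-cycle Rp x~y (s≤s (s≤s (s≤s z≤n)))
    same : SameCycle G c R
    same = cactus x y c R x~y cyc (proj₁ closed) xy-on-c (inj₁ (proj₂ closed))
    on-closed : ∀ {u v} → (u , v) ∈ cycleSteps G R → Alternates g (u , v) ⊎ (u ≡ x × v ≡ y)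
    on-closed e∈ with ∈-steps-∷ʳ⁻ R y e∈
    ... | inj₁ e∈R         = inj₁ (All.lookup alts e∈R)
    ... | inj₂ (l′ , v≡y) = inj₂ (just-injective (trans (sym l′) l) , v≡y)
    on-c : ∀ {u v} → (u , v) ∈ cycleSteps G c → Alternates g (u , v) ⊎ Orientation (u , v) x y
    on-c {u} {v} e∈ with proj₁ (same u v) (inj₁ e∈)
    ... | inj₁ uv∈ = Sum.map₂ inj₁ (on-closed uv∈)
    ... | inj₂ vu∈ = Sum.map (Alternates-sym g) (λ (v≡x , u≡y) → inj₂ (u≡y , v≡x)) (on-closed vu∈)
    alternates-xy : (x , y) ∈ cycleSteps G c → Alternates g (x , y)
    alternates-xy xy∈ = even-cycle-alternates g cyc even xy∈ on-c
    alternates-yx : (y , x) ∈ cycleSteps G c → Alternates g (x , y)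
    alternates-yx yx∈ = Alternates-sym g (even-cycle-alternates g cyc even yx∈ (Sum.map₂ Sum.swap ∘ on-c))

  Traverses : List (V G) → V G → V G → Set
  Traverses p x y = (x , y) ∈ steps G p ⊎ (y , x) ∈ steps G p

  Traverses⇒∈ : ∀ {p x y} → Traverses p x y → x ∈ p
  Traverses⇒∈ {p} (inj₁ xy∈) = ∈-steps⇒∈ˡ p xy∈
  Traverses⇒∈ {p} (inj₂ yx∈) = ∈-steps⇒∈ʳ p yx∈

  module Distances (s : V G) (sp : ∀ v → ∃ λ p → IsShortestPath G p s v) where

    path-to : V G → List (V G)
    path-to v = proj₁ (sp v)

    shortest-to : ∀ v → IsShortestPath G (path-to v) s v
    shortest-to v = proj₂ (sp v)

    dist : V G → ℕ
    dist v = len G (path-to v)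

    dist-prefix : ∀ {t} xs w ys → IsShortestPath G (xs ++ w ∷ ys) s t → dist w ≡ length xs
    dist-prefix xs w ys spp =
      trans (shortest-len-unique (shortest-to w) (shortest-prefix xs w ys spp)) (len-∷ʳ xs w)

    dist-step : ∀ {p t u v} → IsShortestPath G p s t → (u , v) ∈ steps G p → dist v ≡ suc (dist u)
    dist-step {p} {t} {u} {v} spp e∈ with ∈-steps⇒∃++ p e∈
    ... | xs , ys , refl = begin
      dist v               ≡⟨ dist-prefix (xs ++ [ u ]) v ys spp′ ⟩
      length (xs ++ [ u ]) ≡⟨ length-++ xs ⟩
      length xs + 1        ≡⟨ +-comm (length xs) 1 ⟩
      suc (length xs)      ≡⟨ cong suc (dist-prefix xs u (v ∷ ys) spp) ⟨
      suc (dist u)         ∎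
      where
      open ≡-Reasoning
      spp′ : IsShortestPath G ((xs ++ [ u ]) ++ v ∷ ys) s t
      spp′ = subst (λ q → IsShortestPath G q s t) (sym (++-assoc xs [ u ] (v ∷ ys))) spp

    parity-dist : V G → Parity
    parity-dist = parity ∘ dist

    shortest-alternates : ∀ {p t} → IsShortestPath G p s t → All (Alternates parity-dist) (steps G p)
    shortest-alternates spp = All.tabulate λ { {u , _} e∈ →
      trans (cong parity (dist-step spp e∈)) (parity-suc (dist u)) }

    -- Back to s along one shortest path, out along another, then erase loops.
    alternating-path : ∀ v w → ∃ λ R → IsPath G R v w × All (Alternates parity-dist) (steps G R)
    alternating-path v w
      with walk-++ (walk-reverse (path⇒walk (proj₁ (shortest-to v)))) (path⇒walk (proj₁ (shortest-to w)))
    ... | W , Ww , steps-W with walk⇒path Ww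
    ...   | R , Rp , R⊆W , _ =
      R , Rp ,
      All.anti-mono R⊆W (subst (All _) (sym steps-W) (All.++⁺ reverse-alts (shortest-alternates (shortest-to w))))
      where
      reverse-alts : All (Alternates parity-dist) (steps G (reverse (path-to v)))
      reverse-alts = All.tabulate λ { {_ , _} e∈ → Alternates-sym parity-dist
        (All.lookup (shortest-alternates (shortest-to v)) (∈-steps-reverse (path-to v) e∈)) }

    even-cycle-edge-dist-≢ : ∀ {x y} → IsCactus G → OnEvenCycle G x y → dist x ≢ dist y
    even-cycle-edge-dist-≢ {x} {y} cactus (x~y , c , cyc , even , xy-on-c) dx≡dy with alternating-path y x
    ... | R , Rp , alts = p≢p⁻¹ (parity-dist x)
      (trans (cong parity dx≡dy) (cactus-even-cycle-alternates parity-dist cactus x~y cyc even xy-on-c Rp alts))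

    even-cycle-edge-on-shortest-path : ∀ {x y} → IsCactus G → OnEvenCycle G x y →
                                       ∃₂ λ p t → IsShortestPath G p s t × Traverses p x y
    even-cycle-edge-on-shortest-path {x} {y} cactus on-even@(x~y , _) with <-cmp (dist x) (dist y)
    ... | tri< dx<dy _ _ =
      _ , _ , shortest-∷ʳ (shortest-to x) (shortest-to y) dx<dy x~y ,
      inj₁ (∈-steps-∷ʳ⁺ (path-to x) y (proj₁ (proj₂ (proj₁ (shortest-to x)))))
    ... | tri≈ _ dx≡dy _ = ⊥-elim (even-cycle-edge-dist-≢ cactus on-even dx≡dy)
    ... | tri> _ _ dy<dx =
      _ , _ , shortest-∷ʳ (shortest-to y) (shortest-to x) dy<dx (Adj-sym x~y) ,
      inj₂ (∈-steps-∷ʳ⁺ (path-to y) x (proj₁ (proj₂ (proj₁ (shortest-to y)))))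

  bridge-sym : ∀ {s s′} → IsBridge G s s′ → IsBridge G s′ s
  bridge-sym (s~s′ , off-cycles) = Adj-sym s~s′ , λ c cyc on-c → off-cycles c cyc (Sum.swap on-c)

  bridge-separates : ∀ {s s′ P P′ t t′ w} → IsBridge G s s′ → IsPath G P s t → IsPath G P′ s′ t′ →
                     w ∈ P → w ∈ P′ → s′ ∉ P → s ∉ P′ → ⊥
  bridge-separates {s} {s′} (s~s′ , off-cycles) Pp P′p w∈P w∈P′ s′∉P s∉P′
    with path-prefix-to Pp w∈P | path-prefix-to P′p w∈P′
  ... | Q , Qp , Q⊆P , _ | Q′ , Q′p , Q′⊆P′ , _
    with walk-++ (path⇒walk Qp) (walk-reverse (path⇒walk Q′p))
  ... | W , Ww , steps-W with walk⇒path Ww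
  ... | R , Rp@(h , l , _) , R⊆W , _ with head≡just⇒∷ {xs = R} h
  ... | []          , refl = Adj⇒≢ s~s′ (just-injective l)
  ... | r ∷ []      , refl with just-injective l
  ...   | refl with ∈-++⁻ (steps G Q) (subst (_ ∈_) steps-W (R⊆W (here refl)))
  ...     | inj₁ ss′∈Q   = s′∉P (Q⊆P (∈-steps⇒∈ʳ Q ss′∈Q))
  ...     | inj₂ ss′∈Q′ʳ = s∉P′ (Q′⊆P′ (∈-steps⇒∈ʳ Q′ (∈-steps-reverse Q′ ss′∈Q′ʳ)))
  bridge-separates {s} {s′} (s~s′ , off-cycles) Pp P′p w∈P w∈P′ s′∉P s∉P′
      | _ | _ | _ | R , Rp , _ | r ∷ r′ ∷ R′ , refl =
    off-cycles R (proj₁ closed) (inj₂ (proj₂ closed))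
    where
    closed : IsCycle G R × (s′ , s) ∈ cycleSteps G R
    closed = path-closes-cycle Rp (Adj-sym s~s′) (s≤s (s≤s (s≤s z≤n)))

  vsrc-shortest-injective : ∀ {C : Set} {col : V G → V G → C} {p u v e₁ e₂} → IsVSRC G col →
    IsShortestPath G p u v → e₁ ∈ steps G p → e₂ ∈ steps G p →
    uncurry col e₁ ≡ uncurry col e₂ → e₁ ≡ e₂
  vsrc-shortest-injective {col = col} {p} (_ , rainbow) spp =
    Unique-map⇒injectiveOn (uncurry col) (steps G p) (rainbow _ _ p spp)

  bridge-colour-≢ : ∀ {C : Set} {col : V G → V G → C} {s s′ x y c p t} → IsVSRC G col →
    IsBridge G s s′ → Adj G x y → IsCycle G c → EdgeOn G x y c →
    IsShortestPath G p s t → s′ ∈ p → Traverses p x y → col s s′ ≢ col x y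
  bridge-colour-≢ {col = col} {s} {s′} {x} {y} {c} {p} vsrc@(col-sym , _) (s~s′ , off-cycles) x~y cyc
                  xy-on-c spp s′∈p xy∈p ss′≡xy
    with shortest-through-neighbour spp s~s′ s′∈p
  ... | _ , refl = off-cycles c cyc (on-c same-edge)
    where
    injective : ∀ {e} → e ∈ steps G p → col s s′ ≡ uncurry col e → (s , s′) ≡ e
    injective = vsrc-shortest-injective vsrc spp (here refl)
    same-edge : (s , s′) ≡ (x , y) ⊎ (s , s′) ≡ (y , x)
    same-edge = Sum.map (λ xy∈ → injective xy∈ ss′≡xy)
                        (λ yx∈ → injective yx∈ (trans ss′≡xy (col-sym x y x~y))) xy∈p
    on-c : (s , s′) ≡ (x , y) ⊎ (s , s′) ≡ (y , x) → EdgeOn G s s′ c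
    on-c (inj₁ refl) = xy-on-c
    on-c (inj₂ refl) = Sum.swap xy-on-c

lemma10 : (G : Graph) → Connected G → IsCactus G
    → (a b x y : V G) → IsBridge G a b → OnEvenCycle G x y
    → {C : Set} → (col : V G → V G → C) → IsVSRC G col
    → col a b ≢ col x y
lemma10 G conn cactus a b x y bridge on-even@(x~y , _ , cyc , _ , xy-on-c) col vsrc@(col-sym , _) ab≡xy =
  traversing a λ (_ , _ , spa , xy∈Pa) →
  traversing b λ (_ , _ , spb , xy∈Pb) →
  separate spa xy∈Pa spb xy∈Pb
  where
  open import Data.List.Membership.DecPropositional (Fin._≟_ {Graph.n G}) using (_∈?_)
  traversing : ∀ s → ¬ ¬ (∃₂ λ p t → IsShortestPath G p s t × Traverses G p x y)
  traversing s = ¬¬-map (λ sp → Distances.even-cycle-edge-on-shortest-path G s sp cactus on-even)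
                        (shortest-paths-from G conn s)
  separate : ∀ {Pa ta Pb tb} → IsShortestPath G Pa a ta → Traverses G Pa x y →
             IsShortestPath G Pb b tb → Traverses G Pb x y → ⊥
  separate {Pa} {_} {Pb} spa xy∈Pa spb xy∈Pb with b ∈? Pa | a ∈? Pb
  ... | yes b∈Pa | _        = bridge-colour-≢ G vsrc bridge x~y cyc xy-on-c spa b∈Pa xy∈Pa ab≡xy
  ... | no _     | yes a∈Pb =
    bridge-colour-≢ G vsrc (bridge-sym G bridge) x~y cyc xy-on-c spb a∈Pb xy∈Pb
      (trans (col-sym b a (Adj-sym G (proj₁ bridge))) ab≡xy)
  ... | no b∉Pa  | no a∉Pb  =
    bridge-separates G bridge (proj₁ spa) (proj₁ spb)
      (Traverses⇒∈ G xy∈Pa) (Traverses⇒∈ G xy∈Pb) b∉Pa a∉Pb
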